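{- For all ${\sf FIL}$-formulas $A,B,C$: ${\sf FIL}\vdash A\rhd B\to(\Diamond A\wedge\Box C)\rhd(B\wedge\Box C)$ (the principle $\mathsf M_0$).
   Context: The logic ${\sf FIL}$: the language has propositional variables, interpretation variables $k_0,k_1,\dots$, one interpretation constant ${\sf id}$, $\top,\bot$, Boolean connectives and modalities $\Box^{\mathfrak a}A$, $A\rhd^{\mathfrak a}B$ where $\mathfrak a$ is a finite sequence of interpretation terms without repetition; unlabelled $\Box,\rhd$ stand for label ${\sf id}$ / the empty sequence; $\Diamond^{\mathfrak a}:=\neg\Box^{\mathfrak a}\neg$; $\mathfrak a,k$ is $\mathfrak a$ extended by $k$. Sequents $\Gamma\vdash C$ with $\Gamma$ a multiset, with $\Gamma,\Delta\vdash C$ iff $\Delta\vdash\bigwedge\Gamma\to C$. Axioms/rules (for all labels $\mathfrak a,\mathfrak b$, terms $k$): all tautologies; modus ponens; $\Box^{\mathfrak a}(A\to B)\to(\Box^{\mathfrak a}A\to\Box^{\mathfrak a}B)$; $\Box^{\mathfrak b}A\to\Box^{\mathfrak a}\Box^{\mathfrak b}A$; $\Box^{\mathfrak a}(\Box^{\mathfrak a}A\to A)\to\Box^{\mathfrak a}A$; $\Box^{\mathfrak a}(A\to B)\to A\rhd^{\mathfrak a}B$; $(A\rhd B)\wedge(B\rhd^{\mathfrak a}C)\to A\rhd^{\mathfrak a}C$; $(A\rhd^{\mathfrak a}B)\wedge\Box^{\mathfrak a}(B\to C)\to A\rhd^{\mathfrak a}C$; $(A\rhd^{\mathfrak a}C)\wedge(B\rhd^{\mathfrak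 a}C)\to A\vee B\rhd^{\mathfrak a}C$; $A\rhd^{\mathfrak a}B\to(\Diamond A\to\Diamond^{\mathfrak a}B)$; $A\rhd^{\mathfrak a}\Diamond^{\mathfrak b}B\to A\rhd^{\mathfrak b}B$; $\Box^{\mathfrak a,k}A\to\Box^{\mathfrak a}A$; $A\rhd^{\mathfrak a}B\to A\rhd^{\mathfrak a,k}B$; necessitation $\vdash A\Rightarrow\vdash\Box^{\mathfrak a}A$; rule $\mathsf P^{\mathfrak a,\mathfrak b,k}$: from $\Gamma,\Delta,\Box^{\mathfrak b}(A\rhd^{\mathfrak a,k}B)\vdash C$ infer $\Gamma,A\rhd^{\mathfrak a}B\vdash C$, provided $k$ is an interpretation variable not occurring in $\mathfrak a,\Gamma,A,B,C$ and $\Delta$ consists of formulas of the forms $E\rhd^{\mathfrak a,k}F\to E\rhd^{\mathfrak a}F$ and $\Box^{\mathfrak a}E\to\Box^{\mathfrak a,k}E$. -}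

module Defs where

open import Data.Nat using (ℕ)
open import Data.Bool using (Bool; true; false; _∧_; _∨_; not)
open import Data.Empty using (⊥)
open import Data.Sum using (_⊎_)
open import Data.Product using (_×_)
open import Data.List using (List; []; _∷_; _++_; [_])
open import Data.List.Relation.Unary.All using (All)
open import Relation.Nullary using (¬_)
open import Relation.Binary.PropositionalEquality using (_≡_)

data ITerm : Set where
  ivar : ℕ → ITerm
  iid  : ITerm

-- Labels: finite sequences of interpretation terms WITHOUT repetition.
-- Built by extension at the end ("𝔞 , k"), carrying a proof that k is
-- fresh for 𝔞 (induction-recursion).

mutual
  data Label : Set where
    ε    : Label
    snoc : (a : Label) (k : ITerm) → ¬ (k ∈L a) → Label

  _∈L_ : ITerm → Label → Set
  k ∈L ε            = ⊥
  k ∈L snoc a j _   = (k ∈L a) ⊎ (k ≡ j)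

infixr 5 _⇒_
infixr 6 _∨'_
infixr 7 _∧'_

data Fm : Set where
  pv     : ℕ → Fm
  ⊤' ⊥'  : Fm
  ¬'     : Fm → Fm
  _∧'_   : Fm → Fm → Fm
  _∨'_   : Fm → Fm → Fm
  _⇒_    : Fm → Fm → Fm
  □⟨_⟩_  : Label → Fm → Fm
  _▷⟨_⟩_ : Fm → Label → Fm → Fm

□_ : Fm → Fm
□ A = □⟨ ε ⟩ A

_▷_ : Fm → Fm → Fm
A ▷ B = A ▷⟨ ε ⟩ B

◇⟨_⟩_ : Label → Fm → Fm
◇⟨ a ⟩ A = ¬' (□⟨ a ⟩ (¬' A))

◇_ : Fm → Fm
◇ A = ◇⟨ ε ⟩ A

eval : (Fm → Bool) → Fm → Bool
eval v (pv n)        = v (pv n)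
eval v ⊤'            = true
eval v ⊥'            = false
eval v (¬' A)        = not (eval v A)
eval v (A ∧' B)      = eval v A ∧ eval v B
eval v (A ∨' B)      = eval v A ∨ eval v B
eval v (A ⇒ B)       = not (eval v A) ∨ eval v B
eval v (□⟨ a ⟩ A)    = v (□⟨ a ⟩ A)
eval v (A ▷⟨ a ⟩ B)  = v (A ▷⟨ a ⟩ B)

Tautology : Fm → Set
Tautology A = (v : Fm → Bool) → eval v A ≡ true

OccF : ℕ → Fm → Set
OccF n (pv _)        = ⊥
OccF n ⊤'            = ⊥
OccF n ⊥'            = ⊥
OccF n (¬' A)        = OccF n A
OccF n (A ∧' B)      = OccF n A ⊎ OccF n B
OccF n (A ∨' B)      = OccF n A ⊎ OccF n B
OccF n (A ⇒ B)       = OccF n A ⊎ OccF n B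
OccF n (□⟨ a ⟩ A)    = (ivar n ∈L a) ⊎ OccF n A
OccF n (A ▷⟨ a ⟩ B)  = OccF n A ⊎ (ivar n ∈L a) ⊎ OccF n B

OccL : ℕ → List Fm → Set
OccL n []       = ⊥
OccL n (A ∷ Γ)  = OccF n A ⊎ OccL n Γ

-- Conjunction of a (multi)set of formulas; sequents Γ ⊢ C mean ⊢ ⋀Γ → C

⋀ : List Fm → Fm
⋀ []       = ⊤'
⋀ (A ∷ Γ)  = A ∧' ⋀ Γ

data ΔForm (a : Label) (k : ITerm) (p : ¬ (k ∈L a)) : Fm → Set where
  δ▷ : ∀ E F → ΔForm a k p ((E ▷⟨ snoc a k p ⟩ F) ⇒ (E ▷⟨ a ⟩ F))
  δ□ : ∀ E   → ΔForm a k p ((□⟨ a ⟩ E) ⇒ (□⟨ snoc a k p ⟩ E))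

data ⊢_ : Fm → Set where
  taut  : ∀ {A} → Tautology A → ⊢ A
  mp    : ∀ {A B} → ⊢ (A ⇒ B) → ⊢ A → ⊢ B
  axK   : ∀ a A B → ⊢ (□⟨ a ⟩ (A ⇒ B) ⇒ (□⟨ a ⟩ A ⇒ □⟨ a ⟩ B))
  ax4   : ∀ a b A → ⊢ (□⟨ b ⟩ A ⇒ □⟨ a ⟩ □⟨ b ⟩ A)
  axL   : ∀ a A → ⊢ (□⟨ a ⟩ (□⟨ a ⟩ A ⇒ A) ⇒ □⟨ a ⟩ A)
  axJ1  : ∀ a A B → ⊢ (□⟨ a ⟩ (A ⇒ B) ⇒ (A ▷⟨ a ⟩ B))
  axJ2  : ∀ a A B C → ⊢ (((A ▷ B) ∧' (B ▷⟨ a ⟩ C)) ⇒ (A ▷⟨ a ⟩ C))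
  axJ2' : ∀ a A B C → ⊢ (((A ▷⟨ a ⟩ B) ∧' □⟨ a ⟩ (B ⇒ C)) ⇒ (A ▷⟨ a ⟩ C))
  axJ3  : ∀ a A B C → ⊢ (((A ▷⟨ a ⟩ C) ∧' (B ▷⟨ a ⟩ C)) ⇒ ((A ∨' B) ▷⟨ a ⟩ C))
  axJ4  : ∀ a A B → ⊢ ((A ▷⟨ a ⟩ B) ⇒ (◇ A ⇒ ◇⟨ a ⟩ B))
  axJ5  : ∀ a b A B → ⊢ ((A ▷⟨ a ⟩ (◇⟨ b ⟩ B)) ⇒ (A ▷⟨ b ⟩ B))
  axM□  : ∀ a k (p : ¬ (k ∈L a)) A → ⊢ (□⟨ snoc a k p ⟩ A ⇒ □⟨ a ⟩ A)
  axM▷  : ∀ a k (p : ¬ (k ∈L a)) A B → ⊢ ((A ▷⟨ a ⟩ B) ⇒ (A ▷⟨ snoc a k p ⟩ B))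
  nec   : ∀ a {A} → ⊢ A → ⊢ (□⟨ a ⟩ A)
  ruleP : ∀ a b n (p : ¬ (ivar n ∈L a)) (Γ Δ : List Fm) A B C →
          ¬ OccL n Γ → ¬ OccF n A → ¬ OccF n B → ¬ OccF n C →
          All (ΔForm a (ivar n) p) Δ →
          ⊢ (⋀ (Γ ++ Δ ++ [ □⟨ b ⟩ (A ▷⟨ snoc a (ivar n) p ⟩ B) ]) ⇒ C) →
          ⊢ (⋀ (Γ ++ [ A ▷⟨ a ⟩ B ]) ⇒ C)

{-# OPTIONS --safe #-}
-- Write D = ◇A ∧ □C and E = B ∧ □C. Rule P (for the empty label) reduces the
-- claim to deriving D ▷ E from □(A ▷ᵏ B) and D ▷ᵏ E → D ▷ E, for an
-- interpretation variable k fresh for A, B, C. Inside the box, J4 gives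
-- A ▷ᵏ B → (◇A → ◇ᵏB), and □C → □ᵏ□C (axiom 4) upgrades ◇ᵏB to ◇ᵏE, so
-- □(D → ◇ᵏE); J1 and J5 turn this into D ▷ᵏ E.
module Submission where

open import Defs
open import Data.Bool using (Bool; true; false; T; not; _∨_)
open import Data.Bool.Properties using (T-≡; T-∧; T-∨)
open import Data.Empty using (⊥; ⊥-elim)
open import Data.Unit using (⊤)
open import Data.Nat using (ℕ; zero; suc; _≤_; _⊔_)
open import Data.Nat.Properties using (≤-refl; n≮n; m⊔n≤o⇒m≤o; m⊔n≤o⇒n≤o)
open import Data.Product using (_×_; _,_)
open import Data.Product.Function.NonDependent.Propositional using (_×-⇔_)
open import Data.Sum using (_⊎_; inj₁; inj₂; [_,_])
open import Data.Sum.Function.Propositional using (_⊎-⇔_)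
open import Data.List using ([])
open import Data.List.Relation.Unary.All using ([]; _∷_)
open import Function using (_∘_; id)
open import Function.Bundles using (_⇔_; mk⇔; Equivalence)
open import Function.Construct.Composition using (_⇔-∘_)
open import Function.Construct.Symmetry using (⇔-sym)
open import Relation.Nullary using (¬_)
open import Relation.Binary.PropositionalEquality using (_≡_; refl)

open Equivalence using (to; from)

-- A Set-valued reading of eval, so that tautologies can be proved by λ-terms.
infix 4 _⊨_

_⊨_ : (Fm → Bool) → Fm → Set
v ⊨ pv n          = T (v (pv n))
v ⊨ ⊤'            = ⊤
v ⊨ ⊥'            = ⊥
v ⊨ ¬' A          = ¬ (v ⊨ A)
v ⊨ (A ∧' B)      = v ⊨ A × v ⊨ B
v ⊨ (A ∨' B)      = v ⊨ A ⊎ v ⊨ B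
v ⊨ (A ⇒ B)       = v ⊨ A → v ⊨ B
v ⊨ (□⟨ a ⟩ A)    = T (v (□⟨ a ⟩ A))
v ⊨ (A ▷⟨ a ⟩ B)  = T (v (A ▷⟨ a ⟩ B))

¬-cong-T : ∀ {P : Set} {a} → P ⇔ T a → (¬ P) ⇔ T (not a)
¬-cong-T {a = true}  p = mk⇔ (λ ¬p → ¬p (from p _)) (λ ())
¬-cong-T {a = false} p = mk⇔ _ (λ _ → to p)

→-cong-T : ∀ {P Q : Set} {a b} → P ⇔ T a → Q ⇔ T b → (P → Q) ⇔ T (not a ∨ b)
→-cong-T {a = true}  p q = mk⇔ (λ f → to q (f (from p _))) (λ b _ → from q b)
→-cong-T {a = false} p q = mk⇔ _ (λ _ → ⊥-elim ∘ to p)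

⊨⇔T-eval : ∀ v A → v ⊨ A ⇔ T (eval v A)
⊨⇔T-eval v (pv n)        = mk⇔ id id
⊨⇔T-eval v ⊤'            = mk⇔ _ _
⊨⇔T-eval v ⊥'            = mk⇔ (λ ()) (λ ())
⊨⇔T-eval v (¬' A)        = ¬-cong-T (⊨⇔T-eval v A)
⊨⇔T-eval v (A ∧' B)      = ⇔-sym T-∧ ⇔-∘ (⊨⇔T-eval v A ×-⇔ ⊨⇔T-eval v B)
⊨⇔T-eval v (A ∨' B)      = ⇔-sym T-∨ ⇔-∘ (⊨⇔T-eval v A ⊎-⇔ ⊨⇔T-eval v B)
⊨⇔T-eval v (A ⇒ B)       = →-cong-T (⊨⇔T-eval v A) (⊨⇔T-eval v B)
⊨⇔T-eval v (□⟨ a ⟩ A)    = mk⇔ id id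
⊨⇔T-eval v (A ▷⟨ a ⟩ B)  = mk⇔ id id

tautology : ∀ {A} → (∀ v → v ⊨ A) → ⊢ A
tautology {A} h = taut (λ v → to T-≡ (to (⊨⇔T-eval v A) (h v)))

taut-consequence : ∀ {P Q} → ⊢ P → (∀ v → v ⊨ P → v ⊨ Q) → ⊢ Q
taut-consequence p h = mp (tautology h) p

taut-consequence₂ : ∀ {P Q R} → ⊢ P → ⊢ Q → (∀ v → v ⊨ P → v ⊨ Q → v ⊨ R) → ⊢ R
taut-consequence₂ p q h = mp (mp (tautology h) p) q

⇒-trans : ∀ {A B C} → ⊢ (A ⇒ B) → ⊢ (B ⇒ C) → ⊢ (A ⇒ C)
⇒-trans p q = taut-consequence₂ p q (λ _ f g → g ∘ f)

□-mono : ∀ a {A B} → ⊢ (A ⇒ B) → ⊢ (□⟨ a ⟩ A ⇒ □⟨ a ⟩ B)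
□-mono a {A} {B} p = mp (axK a A B) (nec a p)

□⇒◇-∧ : ∀ a B C → ⊢ (□⟨ a ⟩ C ⇒ (◇⟨ a ⟩ B ⇒ ◇⟨ a ⟩ (B ∧' C)))
□⇒◇-∧ a B C = taut-consequence
  (⇒-trans (□-mono a (tautology λ _ c ¬bc b → ¬bc (b , c))) (axK a (¬' (B ∧' C)) (¬' B)))
  (λ _ f c ◇b □¬bc → ◇b (f c □¬bc))

□⇒◇-▷ : ∀ b A B → ⊢ (□ (A ⇒ ◇⟨ b ⟩ B) ⇒ (A ▷⟨ b ⟩ B))
□⇒◇-▷ b A B = ⇒-trans (axJ1 ε A (◇⟨ b ⟩ B)) (axJ5 ε b A B)

□▷⇒M₀ : ∀ k A B C → ⊢ (□ (A ▷⟨ k ⟩ B) ⇒ ((◇ A ∧' □ C) ▷⟨ k ⟩ (B ∧' □ C)))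
□▷⇒M₀ k A B C = ⇒-trans (□-mono ε ▷⇒M₀-under-□) (□⇒◇-▷ k (◇ A ∧' □ C) (B ∧' □ C))
  where
  ▷⇒M₀-under-□ : ⊢ ((A ▷⟨ k ⟩ B) ⇒ ((◇ A ∧' □ C) ⇒ ◇⟨ k ⟩ (B ∧' □ C)))
  ▷⇒M₀-under-□ = taut-consequence₂ (axJ4 k A B) (⇒-trans (ax4 k ε C) (□⇒◇-∧ k B (□ C)))
    (λ _ j4 □◇ ab (◇a , □c) → □◇ □c (j4 ab ◇a))

FreshFrom : (ℕ → Set) → ℕ → Set
FreshFrom Occ m = ∀ {n} → m ≤ n → ¬ Occ n

⊎-freshFrom : ∀ {P Q : ℕ → Set} {m k} →
              FreshFrom P m → FreshFrom Q k → FreshFrom (λ n → P n ⊎ Q n) (m ⊔ k)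
⊎-freshFrom {m = m} {k} p q le = [ p (m⊔n≤o⇒m≤o m k le) , q (m⊔n≤o⇒n≤o m k le) ]

freshT : ITerm → ℕ
freshT (ivar m) = suc m
freshT iid      = zero

freshL : Label → ℕ
freshL ε            = zero
freshL (snoc a k _) = freshL a ⊔ freshT k

fresh : Fm → ℕ
fresh (pv _)        = zero
fresh ⊤'            = zero
fresh ⊥'            = zero
fresh (¬' A)        = fresh A
fresh (A ∧' B)      = fresh A ⊔ fresh B
fresh (A ∨' B)      = fresh A ⊔ fresh B
fresh (A ⇒ B)       = fresh A ⊔ fresh B
fresh (□⟨ a ⟩ A)    = freshL a ⊔ fresh A
fresh (A ▷⟨ a ⟩ B)  = fresh A ⊔ (freshL a ⊔ fresh B)

freshT-≢ : ∀ k → FreshFrom (λ n → ivar n ≡ k) (freshT k)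
freshT-≢ (ivar m) m<m refl = n≮n m m<m
freshT-≢ iid      _   ()

freshL-∉ : ∀ a → FreshFrom (λ n → ivar n ∈L a) (freshL a)
freshL-∉ ε            _ ()
freshL-∉ (snoc a k _) = ⊎-freshFrom (freshL-∉ a) (freshT-≢ k)

fresh-¬OccF : ∀ A → FreshFrom (λ n → OccF n A) (fresh A)
fresh-¬OccF (pv _)        _ ()
fresh-¬OccF ⊤'            _ ()
fresh-¬OccF ⊥'            _ ()
fresh-¬OccF (¬' A)        = fresh-¬OccF A
fresh-¬OccF (A ∧' B)      = ⊎-freshFrom (fresh-¬OccF A) (fresh-¬OccF B)
fresh-¬OccF (A ∨' B)      = ⊎-freshFrom (fresh-¬OccF A) (fresh-¬OccF B)
fresh-¬OccF (A ⇒ B)       = ⊎-freshFrom (fresh-¬OccF A) (fresh-¬OccF B)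
fresh-¬OccF (□⟨ a ⟩ A)    = ⊎-freshFrom (freshL-∉ a) (fresh-¬OccF A)
fresh-¬OccF (A ▷⟨ a ⟩ B)  =
  ⊎-freshFrom (fresh-¬OccF A) (⊎-freshFrom (freshL-∉ a) (fresh-¬OccF B))

mainTheorem5 : (A B C : Fm) → ⊢ ((A ▷ B) ⇒ (((◇ A) ∧' (□ C)) ▷ (B ∧' (□ C))))
mainTheorem5 A B C =
  taut-consequence
    (ruleP ε ε n (λ ()) [] _ A B (D ▷ E) (λ ()) ¬OccA ¬OccB ¬OccG (δ▷ D E ∷ [])
      (taut-consequence (□▷⇒M₀ k A B C) (λ _ h (δ , □ab , _) → δ (h □ab))))
    (λ _ h ab → h (ab , _))
  where
  D E : Fm
  D = ◇ A ∧' □ C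
  E = B ∧' □ C
  n : ℕ
  n = fresh (D ▷ E)
  k : Label
  k = snoc ε (ivar n) (λ ())
  ¬OccG : ¬ OccF n (D ▷ E)
  ¬OccG = fresh-¬OccF (D ▷ E) ≤-refl
  ¬OccA : ¬ OccF n A
  ¬OccA = ¬OccG ∘ inj₁ ∘ inj₁ ∘ inj₂
  ¬OccB : ¬ OccF n B
  ¬OccB = ¬OccG ∘ inj₂ ∘ inj₂ ∘ inj₁
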